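{- For any integer $r\ge1$, there is an instance of scenario submodular cover with $Q=1$ (with $s$ scenarios) in which the expected cost of every $r$-round adaptive solution is $\Omega\big(\frac{1}{r^2\log s}\, s^{1/r}\big)$ times the optimal (fully) adaptive expected cost.
   Context: Scenario submodular cover: a finite ground set $U$, a monotone submodular $f:2^U\to\mathbb{Z}_{\ge0}$ with $Q=f(U)$, items $X_1,\dots,X_m$ with costs $c_i>0$, and an explicitly given joint distribution over realization vectors $(X_1,\dots,X_m)\in U^m$ with $s$ scenarios (support points) of positive probability. Probing $X_i$ reveals its realization at cost $c_i$; a set of probed items covers $f$ if their realizations $S$ satisfy $f(S)=Q$, and solutions must cover $f$ with probability one, minimizing expected total cost. An $r$-round adaptive solution proceeds in $r$ rounds; in round $k$ it specifies an ordering of all remaining items depending only on realizations observed in rounds $1,\dots,k-1$, and probes them in order until some stopping rule. A fully adaptive solution chooses each next item based on all previous observations. -}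

module Defs where

open import Data.Nat as ℕ using (ℕ; zero; suc)
open import Data.Nat.Logarithm using (⌈log₂_⌉)
open import Data.Integer using (+_)
open import Data.Fin using (Fin) renaming (zero to fzero; suc to fsuc)
open import Data.Fin.Subset using (Subset; _⊆_; _∪_; _∩_; ⊤; ⊥; ⁅_⁆)
open import Data.List using (List; []; _∷_)
open import Data.Product using (Σ; _×_; _,_; proj₁; proj₂)
open import Data.Bool using (Bool; if_then_else_)
open import Data.Rational using (ℚ; 0ℚ; 1ℚ; _+_; _*_; _≤_; _<_; _/_)
open import Relation.Binary.PropositionalEquality using (_≡_)

ℕ→ℚ : ℕ → ℚ
ℕ→ℚ n = (+ n) / 1

_^ℚ_ : ℚ → ℕ → ℚ
x ^ℚ zero  = 1ℚ
x ^ℚ suc n = x * (x ^ℚ n)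

sumFin : ∀ {n} → (Fin n → ℚ) → ℚ
sumFin {zero}  g = 0ℚ
sumFin {suc n} g = g fzero + sumFin (λ i → g (fsuc i))

-- Scenario submodular cover instances with s scenarios.
-- Ground set U = Fin u, items X_1..X_m = Fin m, scenarios = Fin s.

record Instance (s : ℕ) : Set where
  field
    u m        : ℕ
    f          : Subset u → ℕ
    monotone   : ∀ {A B} → A ⊆ B → f A ℕ.≤ f B
    submodular : ∀ A B → f (A ∪ B) ℕ.+ f (A ∩ B) ℕ.≤ f A ℕ.+ f B
    cost       : Fin m → ℚ
    cost-pos   : ∀ i → 0ℚ < cost i
    real       : Fin s → Fin m → Fin u
    real-inj   : ∀ σ τ → (∀ i → real σ i ≡ real τ i) → σ ≡ τ
    prob       : Fin s → ℚ
    prob-pos   : ∀ σ → 0ℚ < prob σ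
    prob-sum   : sumFin prob ≡ 1ℚ

  Q : ℕ
  Q = f ⊤

  -- a history of observations: (probed item, its realization); most recent first
  History : Set
  History = List (Fin m × Fin u)

  observed : History → Subset u
  observed []            = ⊥
  observed ((_ , v) ∷ h) = ⁅ v ⁆ ∪ observed h

  covers : History → Set
  covers h = f (observed h) ≡ Q

  histCost : History → ℚ
  histCost []            = 0ℚ
  histCost ((i , _) ∷ h) = cost i + histCost h

  -- Fully adaptive solutions: decision trees.  Each node probes an item
  -- and branches on its realization.
  data Tree : Set where
    stop  : Tree
    probe : Fin m → (Fin u → Tree) → Tree

  runTree : Tree → (Fin m → Fin u) → History → History
  runTree stop        x h = h
  runTree (probe i k) x h = runTree (k (x i)) x ((i , x i) ∷ h)

  treeHist : Tree → Fin s → History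
  treeHist T σ = runTree T (real σ) []

  -- covers f with probability one (every scenario has positive probability)
  TreeFeasible : Tree → Set
  TreeFeasible T = ∀ σ → covers (treeHist T σ)

  treeExpCost : Tree → ℚ
  treeExpCost T = sumFin (λ σ → prob σ * histCost (treeHist T σ))

  -- A round consists of an ordering of items
  -- (chosen as a function of everything observed in earlier rounds) and a
  -- stopping rule; items are probed in order until the stopping rule
  -- (which may look at all observations so far) fires or the ordering is
  -- exhausted.  RPol k = solutions using at most k rounds.
  data RPol : ℕ → Set where
    noMore : RPol zero
    round  : ∀ {k} → List (Fin m) → (History → Bool) → (History → RPol k)
             → RPol (suc k)

  runRound : List (Fin m) → (History → Bool) → (Fin m → Fin u) → History → History
  runRound []       st x h = h
  runRound (i ∷ is) st x h =
    if st h then h else runRound is st x ((i , x i) ∷ h)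

  runR : ∀ {k} → RPol k → (Fin m → Fin u) → History → History
  runR noMore              x h = h
  runR (round o st next) x h = runR (next (runRound o st x h)) x (runRound o st x h)

  rHist : ∀ {k} → RPol k → Fin s → History
  rHist π σ = runR π (real σ) []

  RFeasible : ∀ {k} → RPol k → Set
  RFeasible π = ∀ σ → covers (rHist π σ)

  rExpCost : ∀ {k} → RPol k → ℚ
  rExpCost π = sumFin (λ σ → prob σ * histCost (rHist π σ))

-- "A ≥ c · s^{1/r} / (r² log s) · B", written without roots/division as
--   (r² · ⌈log₂ s⌉ · A)^r ≥ s · (c · B)^r     (all quantities ≥ 0).
RatioBound : (c : ℚ) (r s : ℕ) (A B : ℚ) → Set
RatioBound c r s A B =
  ℕ→ℚ s * ((c * B) ^ℚ r) ≤ (ℕ→ℚ (r ℕ.* r ℕ.* ⌈log₂ s ⌉) * A) ^ℚ r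

-- Scenarios are the 2^d leaves of a complete binary tree of depth d, with uniform probability
-- and unit costs.  Item (ℓ , y) lies on the path of scenario σ when y agrees with σ on the
-- first ℓ bits; it then reveals bit ℓ of σ, or the covering element GOOD when ℓ = d, and
-- otherwise shows OFF.  Walking down the tree is a fully adaptive solution of cost d + 1.
-- Within one round, the realizations of the first k items of the ordering are determined by
-- the deepest on-path item among them and its value, one of 4(k + 1) possibilities.  A run
-- that stops after at most k probes is therefore determined by a transcript with
-- (4(k + 1))^r values, and since a feasible run observes GOOD, which pins down the scenario,
-- at most (4(k + 1))^r scenarios cost at most k.  With k + 1 = 2^t and d = (t + 2) r + 1 half
-- of the scenarios cost more than k, so every r-round solution costs at least 2^(t-1), which
-- is of order s^(1/r) while d + 1 is of order log s.

module Submission where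

open import Defs
open import Data.Nat using (ℕ; _≤_)
open import Data.Product using (Σ; ∃; _×_)
open import Data.Rational using (ℚ; 0ℚ; _<_)
open import Relation.Binary.PropositionalEquality using (_≡_)

open import Algebra.Bundles using (CommutativeMonoid)
open import Data.Bool using (true; false; if_then_else_)
open import Data.Empty using (⊥; ⊥-elim)
open import Data.Fin using (Fin; toℕ; combine; remQuot; quotient; remainder; fromℕ<; inject≤; punchOut; finToFun; funToFin) renaming (zero to fzero; suc to fsuc)
import Data.Fin.Properties as Finₚ
open import Data.Fin.Subset using (Subset; _∈_; _∉_; _⊆_; _∪_; _∩_; ⁅_⁆)
open import Data.Fin.Subset.Properties
  using (_∈?_; ∈⊤; ∉⊥; x∈⁅x⁆; x∈⁅y⁆⇒x≡y; x∈p∪q⁺; x∈p∪q⁻; x∈p∩q⁺; x∈p∩q⁻)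
import Data.Integer as ℤ
import Data.Integer.Properties as ℤₚ
open import Data.List using (List; []; _∷_; length; take)
import Data.List as List
import Data.List.Properties as Listₚ
open import Data.List.Relation.Unary.All using (All; []; _∷_)
import Data.List.Relation.Unary.All as All
open import Data.List.Relation.Unary.Any using (here; there)
open import Data.List.Membership.Propositional using () renaming (_∈_ to _∈ᴸ_)
import Data.Nat as ℕ
open import Data.Nat using (zero; suc; z≤n; s≤s)
open import Data.Nat.Coprimality using (1-coprimeTo) renaming (sym to coprime-sym)
open import Data.Nat.Logarithm using (⌈log₂_⌉; ⌈log₂2^n⌉≡n)
import Data.Nat.Properties as ℕₚ
open import Data.Nat.Tactic.RingSolver using (solve-∀)
import Data.Product
open import Data.Product using (_,_; proj₁; proj₂)
import Data.Rational as ℚ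
import Data.Rational.Properties as ℚₚ
open import Data.Sum using (inj₁; inj₂; [_,_])
open import Data.Vec using (Vec; []; _∷_)
import Data.Vec as Vec
import Data.Vec.Properties as Vecₚ
open import Function using (_∘_; _∘′_)
open import Relation.Binary.Definitions using (DecidableEquality)
open import Relation.Binary.PropositionalEquality
  using (_≢_; refl; sym; trans; cong; cong₂; subst; subst₂; module ≡-Reasoning)
open import Relation.Nullary using (¬_; Dec; yes; no; does; contradiction)
open import Relation.Nullary.Decidable using (dec-true; dec-false)

open import Algebra.Properties.Monoid.Sum ℕₚ.+-0-monoid using (sum; sum-cong-≗)
open import Algebra.Properties.CommutativeSemigroup
  (CommutativeMonoid.commutativeSemigroup ℚₚ.*-1-commutativeMonoid) using (interchange; x∙yz≈y∙xz)

ℕ→ℚ-≡-mkℚ : ∀ n → ℕ→ℚ n ≡ ℚ.mkℚ (ℤ.+ n) 0 (coprime-sym (1-coprimeTo n))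
ℕ→ℚ-≡-mkℚ n = ℚₚ.normalize-coprime (coprime-sym (1-coprimeTo n))

ℕ→ℚ-+ : ∀ a b → ℕ→ℚ (a ℕ.+ b) ≡ ℕ→ℚ a ℚ.+ ℕ→ℚ b
ℕ→ℚ-+ a b rewrite ℕ→ℚ-≡-mkℚ a | ℕ→ℚ-≡-mkℚ b =
  cong (ℚ._/ 1) (sym (cong₂ ℤ._+_ (ℤₚ.*-identityʳ (ℤ.+ a)) (ℤₚ.*-identityʳ (ℤ.+ b))))

ℕ→ℚ-* : ∀ a b → ℕ→ℚ (a ℕ.* b) ≡ ℕ→ℚ a ℚ.* ℕ→ℚ b
ℕ→ℚ-* a b rewrite ℕ→ℚ-≡-mkℚ a | ℕ→ℚ-≡-mkℚ b = cong (ℚ._/ 1) (ℤₚ.pos-* a b)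

ℕ→ℚ-mono-≤ : ∀ {a b} → a ≤ b → ℕ→ℚ a ℚ.≤ ℕ→ℚ b
ℕ→ℚ-mono-≤ {a} {b} a≤b rewrite ℕ→ℚ-≡-mkℚ a | ℕ→ℚ-≡-mkℚ b =
  ℚ.*≤* (subst₂ ℤ._≤_ (sym (ℤₚ.*-identityʳ (ℤ.+ a))) (sym (ℤₚ.*-identityʳ (ℤ.+ b))) (ℤ.+≤+ a≤b))

ℕ→ℚ-1 : ℕ→ℚ 1 ≡ ℚ.1ℚ
ℕ→ℚ-1 = ℕ→ℚ-≡-mkℚ 1

ℕ→ℚ-^ : ∀ a r → ℕ→ℚ (a ℕ.^ r) ≡ ℕ→ℚ a ^ℚ r
ℕ→ℚ-^ a zero    = ℕ→ℚ-1
ℕ→ℚ-^ a (suc r) = trans (ℕ→ℚ-* a (a ℕ.^ r)) (cong (ℕ→ℚ a ℚ.*_) (ℕ→ℚ-^ a r))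

ℕ→ℚ-nonNeg : ∀ n → 0ℚ ℚ.≤ ℕ→ℚ n
ℕ→ℚ-nonNeg n = subst (ℚ._≤ ℕ→ℚ n) (ℕ→ℚ-≡-mkℚ 0) (ℕ→ℚ-mono-≤ {0} {n} z≤n)

ℕ→ℚ-pos : ∀ n .{{_ : ℕ.NonZero n}} → 0ℚ < ℕ→ℚ n
ℕ→ℚ-pos n rewrite ℕ→ℚ-≡-mkℚ n =
  ℚ.*<* (subst (ℤ.+ 0 ℤ.<_) (sym (ℤₚ.*-identityʳ (ℤ.+ n))) (ℤ.+<+ (ℕₚ.n≢0⇒n>0 (ℕ.≢-nonZero⁻¹ n))))

n<2^n : ∀ n → n ℕ.< 2 ℕ.^ n
n<2^n zero    = s≤s z≤n
n<2^n (suc n) = subst (suc n ℕ.<_) (cong (2 ℕ.^ n ℕ.+_) (sym (ℕₚ.+-identityʳ (2 ℕ.^ n))))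
                  (ℕₚ.+-mono-≤ (ℕₚ.m^n>0 2 n) (n<2^n n))

^-distribʳ-* : ∀ x y r → (x ℕ.* y) ℕ.^ r ≡ x ℕ.^ r ℕ.* y ℕ.^ r
^-distribʳ-* x y zero    = refl
^-distribʳ-* x y (suc r) = trans (cong (x ℕ.* y ℕ.*_) (^-distribʳ-* x y r)) (interchangeℕ x y (x ℕ.^ r) (y ℕ.^ r))
  where
  interchangeℕ : ∀ a b c e → a ℕ.* b ℕ.* (c ℕ.* e) ≡ a ℕ.* c ℕ.* (b ℕ.* e)
  interchangeℕ = solve-∀

^ℚ-distribʳ-* : ∀ x y r → (x ℚ.* y) ^ℚ r ≡ x ^ℚ r ℚ.* y ^ℚ r
^ℚ-distribʳ-* x y zero    = sym (ℚₚ.*-identityˡ ℚ.1ℚ)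
^ℚ-distribʳ-* x y (suc r) =
  trans (cong ((x ℚ.* y) ℚ.*_) (^ℚ-distribʳ-* x y r)) (interchange x y (x ^ℚ r) (y ^ℚ r))

*-nonNeg : ∀ {x y} → 0ℚ ℚ.≤ x → 0ℚ ℚ.≤ y → 0ℚ ℚ.≤ x ℚ.* y
*-nonNeg {x} {y} 0≤x 0≤y =
  subst (ℚ._≤ x ℚ.* y) (ℚₚ.*-zeroʳ x) (ℚₚ.*-monoˡ-≤-nonNeg x {{ℚ.nonNegative 0≤x}} 0≤y)

*-mono-≤-nonNeg : ∀ {x y u v} → 0ℚ ℚ.≤ x → 0ℚ ℚ.≤ u → x ℚ.≤ y → u ℚ.≤ v → x ℚ.* u ℚ.≤ y ℚ.* v
*-mono-≤-nonNeg {x} {y} {u} {v} 0≤x 0≤u x≤y u≤v =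
  ℚₚ.≤-trans (ℚₚ.*-monoʳ-≤-nonNeg u {{ℚ.nonNegative 0≤u}} x≤y)
             (ℚₚ.*-monoˡ-≤-nonNeg y {{ℚ.nonNegative (ℚₚ.≤-trans 0≤x x≤y)}} u≤v)

^ℚ-nonNeg : ∀ r {x} → 0ℚ ℚ.≤ x → 0ℚ ℚ.≤ x ^ℚ r
^ℚ-nonNeg zero    0≤x = ℚₚ.nonNegative⁻¹ ℚ.1ℚ
^ℚ-nonNeg (suc r) 0≤x = *-nonNeg 0≤x (^ℚ-nonNeg r 0≤x)

^ℚ-monoˡ-≤ : ∀ r {x y} → 0ℚ ℚ.≤ x → x ℚ.≤ y → x ^ℚ r ℚ.≤ y ^ℚ r
^ℚ-monoˡ-≤ zero    0≤x x≤y = ℚₚ.≤-refl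
^ℚ-monoˡ-≤ (suc r) 0≤x x≤y = *-mono-≤-nonNeg 0≤x (^ℚ-nonNeg r 0≤x) x≤y (^ℚ-monoˡ-≤ r 0≤x x≤y)

module _ (n : ℕ) .{{_ : ℕ.NonZero n}} where

  private instance
    ℕ→ℚ-positive : ℚ.Positive (ℕ→ℚ n)
    ℕ→ℚ-positive = ℚ.positive (ℕ→ℚ-pos n)

    ℕ→ℚ-nonZero : ℚ.NonZero (ℕ→ℚ n)
    ℕ→ℚ-nonZero = ℚₚ.pos⇒nonZero (ℕ→ℚ n)

  1/ℕ : ℚ
  1/ℕ = ℚ.1/ ℕ→ℚ n

  1/ℕ-pos : 0ℚ < 1/ℕ
  1/ℕ-pos = ℚₚ.positive⁻¹ 1/ℕ {{ℚₚ.1/pos⇒pos (ℕ→ℚ n)}}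

  1/ℕ-*-ℕ→ℚ : 1/ℕ ℚ.* ℕ→ℚ n ≡ ℚ.1ℚ
  1/ℕ-*-ℕ→ℚ = ℚₚ.*-inverseˡ (ℕ→ℚ n)

ℕ-ratio-≤ : ∀ q s {a b} .{{_ : ℕ.NonZero q}} .{{_ : ℕ.NonZero s}} →
          s ℕ.* a ≤ q ℕ.* b → 1/ℕ q ℚ.* ℕ→ℚ a ℚ.≤ 1/ℕ s ℚ.* ℕ→ℚ b
ℕ-ratio-≤ q s {a} {b} sa≤qb = begin
  1/ℕ q ℚ.* ℕ→ℚ a                                  ≡⟨ sym (ℚₚ.*-identityˡ _) ⟩
  ℚ.1ℚ ℚ.* (1/ℕ q ℚ.* ℕ→ℚ a)                       ≡⟨ cong (ℚ._* _) (sym (1/ℕ-*-ℕ→ℚ s)) ⟩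
  (1/ℕ s ℚ.* ℕ→ℚ s) ℚ.* (1/ℕ q ℚ.* ℕ→ℚ a)          ≡⟨ interchange (1/ℕ s) (ℕ→ℚ s) (1/ℕ q) (ℕ→ℚ a) ⟩
  (1/ℕ s ℚ.* 1/ℕ q) ℚ.* (ℕ→ℚ s ℚ.* ℕ→ℚ a)          ≡⟨ cong₂ ℚ._*_ (ℚₚ.*-comm (1/ℕ s) (1/ℕ q)) (sym (ℕ→ℚ-* s a)) ⟩
  (1/ℕ q ℚ.* 1/ℕ s) ℚ.* ℕ→ℚ (s ℕ.* a)              ≤⟨ ℚₚ.*-monoˡ-≤-nonNeg (1/ℕ q ℚ.* 1/ℕ s) {{ℚ.nonNegative 0≤1/qs}} (ℕ→ℚ-mono-≤ sa≤qb) ⟩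
  (1/ℕ q ℚ.* 1/ℕ s) ℚ.* ℕ→ℚ (q ℕ.* b)              ≡⟨ cong (1/ℕ q ℚ.* 1/ℕ s ℚ.*_) (ℕ→ℚ-* q b) ⟩
  (1/ℕ q ℚ.* 1/ℕ s) ℚ.* (ℕ→ℚ q ℚ.* ℕ→ℚ b)          ≡⟨ interchange (1/ℕ q) (1/ℕ s) (ℕ→ℚ q) (ℕ→ℚ b) ⟩
  (1/ℕ q ℚ.* ℕ→ℚ q) ℚ.* (1/ℕ s ℚ.* ℕ→ℚ b)          ≡⟨ cong (ℚ._* _) (1/ℕ-*-ℕ→ℚ q) ⟩
  ℚ.1ℚ ℚ.* (1/ℕ s ℚ.* ℕ→ℚ b)                       ≡⟨ ℚₚ.*-identityˡ _ ⟩
  1/ℕ s ℚ.* ℕ→ℚ b                                  ∎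
  where
  open ℚₚ.≤-Reasoning
  0≤1/qs : 0ℚ ℚ.≤ 1/ℕ q ℚ.* 1/ℕ s
  0≤1/qs = *-nonNeg (ℚₚ.<⇒≤ (1/ℕ-pos q)) (ℚₚ.<⇒≤ (1/ℕ-pos s))

sum-const : ∀ n c → sum {n} (λ _ → c) ≡ n ℕ.* c
sum-const zero    c = refl
sum-const (suc n) c = cong (c ℕ.+_) (sum-const n c)

sumFin-cong : ∀ {n} {f g : Fin n → ℚ} → (∀ i → f i ≡ g i) → sumFin f ≡ sumFin g
sumFin-cong {zero}  f≗g = refl
sumFin-cong {suc n} f≗g = cong₂ ℚ._+_ (f≗g fzero) (sumFin-cong (λ i → f≗g (fsuc i)))

sumFin-*-ℕ→ℚ : ∀ {n} p (g : Fin n → ℕ) → sumFin (λ i → p ℚ.* ℕ→ℚ (g i)) ≡ p ℚ.* ℕ→ℚ (sum g)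
sumFin-*-ℕ→ℚ {zero}  p g = sym (trans (cong (p ℚ.*_) (ℕ→ℚ-≡-mkℚ 0)) (ℚₚ.*-zeroʳ p))
sumFin-*-ℕ→ℚ {suc n} p g = begin
  p ℚ.* ℕ→ℚ (g fzero) ℚ.+ sumFin (λ i → p ℚ.* ℕ→ℚ (g (fsuc i)))
    ≡⟨ cong (p ℚ.* ℕ→ℚ (g fzero) ℚ.+_) (sumFin-*-ℕ→ℚ p (λ i → g (fsuc i))) ⟩
  p ℚ.* ℕ→ℚ (g fzero) ℚ.+ p ℚ.* ℕ→ℚ (sum (λ i → g (fsuc i)))
    ≡⟨ sym (ℚₚ.*-distribˡ-+ p _ _) ⟩
  p ℚ.* (ℕ→ℚ (g fzero) ℚ.+ ℕ→ℚ (sum (λ i → g (fsuc i))))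
    ≡⟨ cong (p ℚ.*_) (sym (ℕ→ℚ-+ (g fzero) _)) ⟩
  p ℚ.* ℕ→ℚ (sum g) ∎
  where open ≡-Reasoning

1/ℕ-*-ℕ→ℚ-* : ∀ n .{{_ : ℕ.NonZero n}} a → 1/ℕ n ℚ.* ℕ→ℚ (n ℕ.* a) ≡ ℕ→ℚ a
1/ℕ-*-ℕ→ℚ-* n a = begin
  1/ℕ n ℚ.* ℕ→ℚ (n ℕ.* a)         ≡⟨ cong (1/ℕ n ℚ.*_) (ℕ→ℚ-* n a) ⟩
  1/ℕ n ℚ.* (ℕ→ℚ n ℚ.* ℕ→ℚ a)     ≡⟨ sym (ℚₚ.*-assoc (1/ℕ n) (ℕ→ℚ n) (ℕ→ℚ a)) ⟩
  (1/ℕ n ℚ.* ℕ→ℚ n) ℚ.* ℕ→ℚ a     ≡⟨ cong (ℚ._* ℕ→ℚ a) (1/ℕ-*-ℕ→ℚ n) ⟩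
  ℚ.1ℚ ℚ.* ℕ→ℚ a                  ≡⟨ ℚₚ.*-identityˡ (ℕ→ℚ a) ⟩
  ℕ→ℚ a                           ∎
  where open ≡-Reasoning

sumFin-1/ℕ : ∀ n .{{_ : ℕ.NonZero n}} → sumFin {n} (λ _ → 1/ℕ n) ≡ ℚ.1ℚ
sumFin-1/ℕ n = begin
  sumFin {n} (λ _ → 1/ℕ n)                   ≡⟨ sumFin-cong {n} (λ _ → sym 1/n*1) ⟩
  sumFin {n} (λ _ → 1/ℕ n ℚ.* ℕ→ℚ 1)         ≡⟨ sumFin-*-ℕ→ℚ {n} (1/ℕ n) (λ _ → 1) ⟩
  1/ℕ n ℚ.* ℕ→ℚ (sum {n} (λ _ → 1))          ≡⟨ cong (λ c → 1/ℕ n ℚ.* ℕ→ℚ c) (sum-const n 1) ⟩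
  1/ℕ n ℚ.* ℕ→ℚ (n ℕ.* 1)                    ≡⟨ 1/ℕ-*-ℕ→ℚ-* n 1 ⟩
  ℕ→ℚ 1                                      ≡⟨ ℕ→ℚ-1 ⟩
  ℚ.1ℚ                                       ∎
  where
  open ≡-Reasoning
  1/n*1 : 1/ℕ n ℚ.* ℕ→ℚ 1 ≡ 1/ℕ n
  1/n*1 = trans (cong (1/ℕ n ℚ.*_) ℕ→ℚ-1) (ℚₚ.*-identityʳ (1/ℕ n))

ratioBound-fromℕ : ∀ {c A} r s a b → 0ℚ ℚ.≤ c →
                   s ℕ.* b ℕ.^ r ≤ (r ℕ.* r ℕ.* ⌈log₂ s ⌉ ℕ.* a) ℕ.^ r →
                   c ℚ.* ℕ→ℚ a ℚ.≤ A → RatioBound c r s A (ℕ→ℚ b)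
ratioBound-fromℕ {c} {A} r s a b 0≤c sbʳ≤[La]ʳ ca≤A = begin
  ℕ→ℚ s ℚ.* (c ℚ.* ℕ→ℚ b) ^ℚ r          ≡⟨ cong (ℕ→ℚ s ℚ.*_) (^ℚ-distribʳ-* c (ℕ→ℚ b) r) ⟩
  ℕ→ℚ s ℚ.* (c ^ℚ r ℚ.* ℕ→ℚ b ^ℚ r)     ≡⟨ x∙yz≈y∙xz (ℕ→ℚ s) (c ^ℚ r) (ℕ→ℚ b ^ℚ r) ⟩
  c ^ℚ r ℚ.* (ℕ→ℚ s ℚ.* ℕ→ℚ b ^ℚ r)     ≡⟨ cong (c ^ℚ r ℚ.*_) (sym (trans (ℕ→ℚ-* s _) (cong (ℕ→ℚ s ℚ.*_) (ℕ→ℚ-^ b r)))) ⟩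
  c ^ℚ r ℚ.* ℕ→ℚ (s ℕ.* b ℕ.^ r)        ≤⟨ ℚₚ.*-monoˡ-≤-nonNeg (c ^ℚ r) {{ℚ.nonNegative (^ℚ-nonNeg r 0≤c)}} (ℕ→ℚ-mono-≤ sbʳ≤[La]ʳ) ⟩
  c ^ℚ r ℚ.* ℕ→ℚ ((L ℕ.* a) ℕ.^ r)      ≡⟨ cong (c ^ℚ r ℚ.*_) (trans (ℕ→ℚ-^ (L ℕ.* a) r) (cong (_^ℚ r) (ℕ→ℚ-* L a))) ⟩
  c ^ℚ r ℚ.* (ℕ→ℚ L ℚ.* ℕ→ℚ a) ^ℚ r     ≡⟨ sym (^ℚ-distribʳ-* c _ r) ⟩
  (c ℚ.* (ℕ→ℚ L ℚ.* ℕ→ℚ a)) ^ℚ r        ≡⟨ cong (_^ℚ r) (x∙yz≈y∙xz c (ℕ→ℚ L) (ℕ→ℚ a)) ⟩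
  (ℕ→ℚ L ℚ.* (c ℚ.* ℕ→ℚ a)) ^ℚ r        ≤⟨ ^ℚ-monoˡ-≤ r 0≤Lca (ℚₚ.*-monoˡ-≤-nonNeg (ℕ→ℚ L) {{ℚ.nonNegative (ℕ→ℚ-nonNeg L)}} ca≤A) ⟩
  (ℕ→ℚ L ℚ.* A) ^ℚ r                    ∎
  where
  open ℚₚ.≤-Reasoning
  L : ℕ
  L = r ℕ.* r ℕ.* ⌈log₂ s ⌉
  0≤Lca : 0ℚ ℚ.≤ ℕ→ℚ L ℚ.* (c ℚ.* ℕ→ℚ a)
  0≤Lca = *-nonNeg (ℕ→ℚ-nonNeg L) (*-nonNeg 0≤c (ℕ→ℚ-nonNeg a))

sum-≥-if-few-small : ∀ {n M} k (g : Fin n → ℕ) (code : ∀ i → g i ≤ k → Fin M) →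
                     (∀ i j p q → code i p ≡ code j q → i ≡ j) →
                     suc k ℕ.* n ≤ sum g ℕ.+ suc k ℕ.* M
sum-≥-if-few-small {zero} {M} k g code code-inj =
  subst (_≤ sum g ℕ.+ suc k ℕ.* M) (sym (ℕₚ.*-zeroʳ (suc k))) z≤n
sum-≥-if-few-small {suc n} {M} k g code code-inj with g fzero ℕₚ.≤? k
... | no g₀≰k = begin
  suc k ℕ.* suc n                                 ≡⟨ ℕₚ.*-suc (suc k) n ⟩
  suc k ℕ.+ suc k ℕ.* n                           ≤⟨ ℕₚ.+-mono-≤ (ℕₚ.≰⇒> g₀≰k) tail-bound ⟩
  g fzero ℕ.+ (sum (g ∘′ fsuc) ℕ.+ suc k ℕ.* M)   ≡⟨ sym (ℕₚ.+-assoc (g fzero) _ _) ⟩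
  sum g ℕ.+ suc k ℕ.* M                           ∎
  where
  open ℕₚ.≤-Reasoning
  tail-inj : ∀ i j p q → code (fsuc i) p ≡ code (fsuc j) q → i ≡ j
  tail-inj i j p q eq = Finₚ.suc-injective (code-inj _ _ p q eq)
  tail-bound : suc k ℕ.* n ≤ sum (g ∘′ fsuc) ℕ.+ suc k ℕ.* M
  tail-bound = sum-≥-if-few-small k (g ∘′ fsuc) (code ∘ fsuc) tail-inj
... | yes g₀≤k = head-small code code-inj
  where
  head-small : ∀ {M} (code : ∀ i → g i ≤ k → Fin M) → (∀ i j p q → code i p ≡ code j q → i ≡ j) →
               suc k ℕ.* suc n ≤ sum g ℕ.+ suc k ℕ.* M
  head-small {zero}   code code-inj = contradiction (code fzero g₀≤k) λ ()
  head-small {suc M′} code code-inj = begin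
    suc k ℕ.* suc n                                     ≡⟨ ℕₚ.*-suc (suc k) n ⟩
    suc k ℕ.+ suc k ℕ.* n                               ≤⟨ ℕₚ.+-monoʳ-≤ (suc k) tail-bound ⟩
    suc k ℕ.+ (sum (g ∘′ fsuc) ℕ.+ suc k ℕ.* M′)        ≤⟨ ℕₚ.m≤n+m _ (g fzero) ⟩
    g fzero ℕ.+ (suc k ℕ.+ (sum (g ∘′ fsuc) ℕ.+ suc k ℕ.* M′))
                                                        ≡⟨ rearrange (g fzero) (sum (g ∘′ fsuc)) (suc k) M′ ⟩
    sum g ℕ.+ suc k ℕ.* suc M′                          ∎
    where
    open ℕₚ.≤-Reasoning
    c₀ : Fin (suc M′)
    c₀ = code fzero g₀≤k
    c₀≢ : ∀ i p → c₀ ≡ code (fsuc i) p → ⊥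
    c₀≢ i p eq with code-inj fzero (fsuc i) g₀≤k p eq
    ... | ()
    tail-code : ∀ i → g (fsuc i) ≤ k → Fin M′
    tail-code i p = punchOut (c₀≢ i p)
    tail-inj : ∀ i j p q → tail-code i p ≡ tail-code j q → i ≡ j
    tail-inj i j p q eq = Finₚ.suc-injective (code-inj _ _ p q (Finₚ.punchOut-injective (c₀≢ i p) (c₀≢ j q) eq))
    tail-bound : suc k ℕ.* n ≤ sum (g ∘′ fsuc) ℕ.+ suc k ℕ.* M′
    tail-bound = sum-≥-if-few-small k (g ∘′ fsuc) tail-code tail-inj
    rearrange : ∀ a b c m → a ℕ.+ (c ℕ.+ (b ℕ.+ c ℕ.* m)) ≡ (a ℕ.+ b) ℕ.+ c ℕ.* suc m
    rearrange = solve-∀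

funToFin-cong : ∀ {a b} {f g : Fin a → Fin b} → (∀ i → f i ≡ g i) → funToFin f ≡ funToFin g
funToFin-cong {zero}  _   = refl
funToFin-cong {suc a} f≗g = cong₂ combine (f≗g fzero) (funToFin-cong (f≗g ∘ fsuc))

module _ {n} (g : Fin n) where

  indicator : Subset n → ℕ
  indicator S = if does (g ∈? S) then 1 else 0

  indicator-∈ : ∀ {S} → g ∈ S → indicator S ≡ 1
  indicator-∈ {S} g∈S with g ∈? S
  ... | yes _   = refl
  ... | no  g∉S = contradiction g∈S g∉S

  indicator-∉ : ∀ {S} → g ∉ S → indicator S ≡ 0
  indicator-∉ {S} g∉S with g ∈? S
  ... | yes g∈S = contradiction g∈S g∉S
  ... | no  _   = refl

  indicator≡1⇒∈ : ∀ {S} → indicator S ≡ 1 → g ∈ S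
  indicator≡1⇒∈ {S} eq with g ∈? S
  ... | yes g∈S = g∈S

  indicator-mono : ∀ {A B} → A ⊆ B → indicator A ≤ indicator B
  indicator-mono {A} {B} A⊆B with g ∈? A | g ∈? B
  ... | yes _   | yes _   = ℕₚ.≤-refl
  ... | yes g∈A | no  g∉B = contradiction (A⊆B g∈A) g∉B
  ... | no  _   | _       = z≤n

  indicator-submodular : ∀ A B → indicator (A ∪ B) ℕ.+ indicator (A ∩ B) ≤ indicator A ℕ.+ indicator B
  indicator-submodular A B with g ∈? A | g ∈? B
  ... | yes g∈A | yes g∈B = ℕₚ.≤-reflexive (cong₂ ℕ._+_ (indicator-∈ (x∈p∪q⁺ (inj₁ g∈A))) (indicator-∈ (x∈p∩q⁺ (g∈A , g∈B))))
  ... | yes g∈A | no  g∉B = ℕₚ.≤-reflexive (cong₂ ℕ._+_ (indicator-∈ (x∈p∪q⁺ (inj₁ g∈A))) (indicator-∉ (g∉B ∘ proj₂ ∘ x∈p∩q⁻ A B)))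
  ... | no  g∉A | yes g∈B = ℕₚ.≤-reflexive (cong₂ ℕ._+_ (indicator-∈ (x∈p∪q⁺ (inj₂ g∈B))) (indicator-∉ (g∉A ∘ proj₁ ∘ x∈p∩q⁻ A B)))
  ... | no  g∉A | no  g∉B = ℕₚ.≤-reflexive (cong₂ ℕ._+_ (indicator-∉ ([ g∉A , g∉B ] ∘ x∈p∪q⁻ A B)) (indicator-∉ (g∉A ∘ proj₁ ∘ x∈p∩q⁻ A B)))

module Runs {s} (I : Instance s) where
  open Instance I

  runRound-length-≥ : ∀ o st x h → length h ≤ length (runRound o st x h)
  runRound-length-≥ []      st x h = ℕₚ.≤-refl
  runRound-length-≥ (i ∷ o) st x h with st h
  ... | true  = ℕₚ.≤-refl
  ... | false = ℕₚ.≤-trans (ℕₚ.n≤1+n _) (runRound-length-≥ o st x _)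

  runR-length-≥ : ∀ {r} (π : RPol r) x h → length h ≤ length (runR π x h)
  runR-length-≥ noMore              x h = ℕₚ.≤-refl
  runR-length-≥ (round o st next) x h =
    ℕₚ.≤-trans (runRound-length-≥ o st x h) (runR-length-≥ (next _) x _)

  Consistent : (Fin m → Fin u) → History → Set
  Consistent x = All λ obs → x (proj₁ obs) ≡ proj₂ obs

  runRound-consistent : ∀ o st x h → Consistent x h → Consistent x (runRound o st x h)
  runRound-consistent []      st x h c = c
  runRound-consistent (i ∷ o) st x h c with st h
  ... | true  = c
  ... | false = runRound-consistent o st x _ (refl ∷ c)

  runR-consistent : ∀ {r} (π : RPol r) x h → Consistent x h → Consistent x (runR π x h)
  runR-consistent noMore              x h c = c
  runR-consistent (round o st next) x h c =
    runR-consistent (next _) x _ (runRound-consistent o st x h c)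

  ∈-observed : ∀ {v} h → v ∈ observed h → ∃ λ i → (i , v) ∈ᴸ h
  ∈-observed []            v∈ = ⊥-elim (∉⊥ v∈)
  ∈-observed ((i , w) ∷ h) v∈ with x∈p∪q⁻ ⁅ w ⁆ (observed h) v∈
  ... | inj₁ v∈⁅w⁆ = i , here (cong (i ,_) (x∈⁅y⁆⇒x≡y w v∈⁅w⁆))
  ... | inj₂ v∈h   = Data.Product.map₂ there (∈-observed h v∈h)

  runRound-cong : ∀ k o st {x y} h → All (λ i → x i ≡ y i) (take k o) →
                  length (runRound o st x h) ≤ k ℕ.+ length h → runRound o st x h ≡ runRound o st y h
  runRound-cong k       []      st h x≗y budget = refl
  runRound-cong k       (i ∷ o) st h x≗y budget with st h
  ... | true = refl
  runRound-cong zero    (i ∷ o) st {x} h x≗y budget | false =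
    ⊥-elim (ℕₚ.<-irrefl refl (ℕₚ.≤-trans (runRound-length-≥ o st x _) budget))
  runRound-cong (suc k) (i ∷ o) st {x} {y} h (xᵢ≡yᵢ ∷ x≗y) budget | false =
    trans (runRound-cong k o st ((i , x i) ∷ h) x≗y budget′) (cong (λ v → runRound o st y ((i , v) ∷ h)) xᵢ≡yᵢ)
    where
    budget′ : length (runRound o st x ((i , x i) ∷ h)) ≤ k ℕ.+ suc (length h)
    budget′ = subst (length (runRound o st x ((i , x i) ∷ h)) ≤_) (sym (ℕₚ.+-suc k (length h))) budget

  module Transcripts {K} (k : ℕ) (summary : List (Fin m) → Fin s → Fin K)
    (summary-injective : ∀ o σ τ → summary o σ ≡ summary o τ → All (λ i → real σ i ≡ real τ i) (take k o))
    where

    transcript : ∀ {r} → RPol r → Fin s → History → Fin (K ℕ.^ r)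
    transcript noMore              σ h = fzero
    transcript (round o st next) σ h =
      combine (summary o σ) (transcript (next h′) σ h′)
      where
      h′ : History
      h′ = runRound o st (real σ) h

    runR-determined : ∀ {r} (π : RPol r) σ τ h → transcript π σ h ≡ transcript π τ h →
                      length (runR π (real σ) h) ≤ k ℕ.+ length h → runR π (real σ) h ≡ runR π (real τ) h
    runR-determined noMore σ τ h _ _ = refl
    runR-determined (round o st next) σ τ h same budget
      with Finₚ.combine-injective (summary o σ) _ (summary o τ) _ same
    ... | same-summary , same-rest
      with runRound o st (real τ) h
         | runRound-cong k o st h (summary-injective o σ τ same-summary)
             (ℕₚ.≤-trans (runR-length-≥ (next (runRound o st (real σ) h)) (real σ) _) budget)
    ... | _ | refl = runR-determined (next _) σ τ _ same-rest
                       (ℕₚ.≤-trans budget (ℕₚ.+-monoʳ-≤ k (runRound-length-≥ o st (real σ) h)))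

module _ {a} {A : Set a} where

  data Agree : ∀ {n} → ℕ → Vec A n → Vec A n → Set a where
    agree-zero : ∀ {n} {x y : Vec A n} → Agree 0 x y
    agree-[]   : ∀ {ℓ} → Agree (suc ℓ) [] []
    agree-∷    : ∀ {n ℓ z} {x y : Vec A n} → Agree ℓ x y → Agree (suc ℓ) (z ∷ x) (z ∷ y)

  agree-refl : ∀ {n} ℓ (x : Vec A n) → Agree ℓ x x
  agree-refl zero    x       = agree-zero
  agree-refl (suc ℓ) []      = agree-[]
  agree-refl (suc ℓ) (z ∷ x) = agree-∷ (agree-refl ℓ x)

  agree-sym : ∀ {n ℓ} {x y : Vec A n} → Agree ℓ x y → Agree ℓ y x
  agree-sym agree-zero    = agree-zero
  agree-sym agree-[]      = agree-[]
  agree-sym (agree-∷ xy) = agree-∷ (agree-sym xy)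

  agree-trans : ∀ {n ℓ} {x y z : Vec A n} → Agree ℓ x y → Agree ℓ y z → Agree ℓ x z
  agree-trans agree-zero    _            = agree-zero
  agree-trans agree-[]      agree-[]     = agree-[]
  agree-trans (agree-∷ xy) (agree-∷ yz) = agree-∷ (agree-trans xy yz)

  agree-≤ : ∀ {n ℓ ℓ′} {x y : Vec A n} → ℓ′ ≤ ℓ → Agree ℓ x y → Agree ℓ′ x y
  agree-≤ z≤n       _            = agree-zero
  agree-≤ (s≤s ℓ′≤ℓ) agree-[]     = agree-[]
  agree-≤ (s≤s ℓ′≤ℓ) (agree-∷ xy) = agree-∷ (agree-≤ ℓ′≤ℓ xy)

  agree-full⇒≡ : ∀ {n} {x y : Vec A n} → Agree n x y → x ≡ y
  agree-full⇒≡ {x = []}    {[]}    _            = refl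
  agree-full⇒≡ {x = _ ∷ _} {_ ∷ _} (agree-∷ xy) = cong (_ ∷_) (agree-full⇒≡ xy)

  agree? : DecidableEquality A → ∀ {n} ℓ (x y : Vec A n) → Dec (Agree ℓ x y)
  agree? _≟_ zero    x       y       = yes agree-zero
  agree? _≟_ (suc ℓ) []      []      = yes agree-[]
  agree? _≟_ (suc ℓ) (z ∷ x) (w ∷ y) with z ≟ w | agree? _≟_ ℓ x y
  ... | yes refl | yes xy = yes (agree-∷ xy)
  ... | yes refl | no ¬xy = no λ { (agree-∷ xy) → ¬xy xy }
  ... | no z≢w   | _      = no λ { (agree-∷ _) → z≢w refl }

-- Beyond the end of the vector bitAt returns the junk value 0.
bitAt : ∀ {n} → ℕ → Vec (Fin 2) n → Fin 2
bitAt _       []      = fzero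
bitAt zero    (b ∷ _) = b
bitAt (suc ℓ) (_ ∷ x) = bitAt ℓ x

setBit : ∀ {n} → ℕ → Fin 2 → Vec (Fin 2) n → Vec (Fin 2) n
setBit _       b []      = []
setBit zero    b (_ ∷ x) = b ∷ x
setBit (suc ℓ) b (c ∷ x) = c ∷ setBit ℓ b x

agree-suc⇒bitAt≡ : ∀ {n ℓ} {x y : Vec (Fin 2) n} → Agree (suc ℓ) x y → bitAt ℓ x ≡ bitAt ℓ y
agree-suc⇒bitAt≡               agree-[]     = refl
agree-suc⇒bitAt≡ {ℓ = zero}    (agree-∷ _)  = refl
agree-suc⇒bitAt≡ {ℓ = suc ℓ}   (agree-∷ xy) = agree-suc⇒bitAt≡ xy

agree-extend : ∀ {n ℓ} {x y : Vec (Fin 2) n} → Agree ℓ x y → bitAt ℓ x ≡ bitAt ℓ y → Agree (suc ℓ) x y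
agree-extend {x = []}    {[]}    _            _    = agree-[]
agree-extend {x = b ∷ x} {c ∷ y} agree-zero   refl = agree-∷ agree-zero
agree-extend                     (agree-∷ xy) same = agree-∷ (agree-extend xy same)

agree-setBit : ∀ {n ℓ} {x v : Vec (Fin 2) n} → Agree ℓ x v → Agree (suc ℓ) x (setBit ℓ (bitAt ℓ x) v)
agree-setBit {x = []}    {[]}    _            = agree-[]
agree-setBit {x = b ∷ x} {c ∷ v} agree-zero   = agree-∷ agree-zero
agree-setBit                     (agree-∷ xv) = agree-∷ (agree-setBit xv)

OFF GOOD : Fin 4
OFF  = fzero
GOOD = fsuc (fsuc (fsuc fzero))

bitValue : Fin 2 → Fin 4
bitValue fzero        = fsuc fzero
bitValue (fsuc fzero) = fsuc (fsuc fzero)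

bitValue-injective : ∀ {b c} → bitValue b ≡ bitValue c → b ≡ c
bitValue-injective {fzero}      {fzero}      _ = refl
bitValue-injective {fsuc fzero} {fsuc fzero} _ = refl
bitValue-injective {fzero}      {fsuc fzero} ()
bitValue-injective {fsuc fzero} {fzero}      ()

bitValue≢GOOD : ∀ b → bitValue b ≢ GOOD
bitValue≢GOOD fzero        ()
bitValue≢GOOD (fsuc fzero) ()

module _ {n : ℕ} where

  onPath : Vec (Fin 2) n → ℕ → Fin 4
  onPath x ℓ = if does (ℓ ℕ.≟ n) then GOOD else bitValue (bitAt ℓ x)

  value : Vec (Fin 2) n → ℕ → Vec (Fin 2) n → Fin 4
  value x ℓ y = if does (agree? Finₚ._≟_ ℓ x y) then onPath x ℓ else OFF

  onPath-full : ∀ x → onPath x n ≡ GOOD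
  onPath-full x rewrite dec-true (n ℕ.≟ n) refl = refl

  onPath-≢ : ∀ {ℓ} x → ℓ ≢ n → onPath x ℓ ≡ bitValue (bitAt ℓ x)
  onPath-≢ {ℓ} x ℓ≢n rewrite dec-false (ℓ ℕ.≟ n) ℓ≢n = refl

  onPath≡GOOD⇒full : ∀ x ℓ → onPath x ℓ ≡ GOOD → ℓ ≡ n
  onPath≡GOOD⇒full x ℓ good with ℓ ℕ.≟ n
  ... | yes ℓ≡n = ℓ≡n
  ... | no  ℓ≢n = contradiction (trans (sym (onPath-≢ x ℓ≢n)) good) (bitValue≢GOOD (bitAt ℓ x))

  onPath-prefix : ∀ {ℓ x x′} → Agree (suc ℓ) x x′ → onPath x ℓ ≡ onPath x′ ℓ
  onPath-prefix {ℓ} xx′ = cong (λ b → if does (ℓ ℕ.≟ n) then GOOD else bitValue b) (agree-suc⇒bitAt≡ xx′)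

  value-agree : ∀ {ℓ x y} → Agree ℓ x y → value x ℓ y ≡ onPath x ℓ
  value-agree {ℓ} {x} {y} xy rewrite dec-true (agree? Finₚ._≟_ ℓ x y) xy = refl

  value≢OFF⇒agree : ∀ {ℓ x y} → value x ℓ y ≢ OFF → Agree ℓ x y
  value≢OFF⇒agree {ℓ} {x} {y} with agree? Finₚ._≟_ ℓ x y
  ... | yes xy = λ _ → xy
  ... | no  _  = λ off → contradiction refl off

  value-prefix : ∀ {ℓ x x′} y → Agree (suc ℓ) x x′ → value x ℓ y ≡ value x′ ℓ y
  value-prefix {ℓ} {x} {x′} y xx′ with agree? Finₚ._≟_ ℓ x y | agree? Finₚ._≟_ ℓ x′ y
  ... | yes _  | yes _   = onPath-prefix xx′
  ... | no  _  | no  _   = refl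
  ... | yes xy | no ¬x′y = contradiction (agree-trans (agree-sym (agree-≤ (ℕₚ.n≤1+n ℓ) xx′)) xy) ¬x′y
  ... | no ¬xy | yes x′y = contradiction (agree-trans (agree-≤ (ℕₚ.n≤1+n ℓ) xx′) x′y) ¬xy

  onPath-agree : ∀ {ℓ x x′ y} → Agree ℓ x y → Agree ℓ x′ y → onPath x ℓ ≡ onPath x′ ℓ → Agree (suc ℓ) x x′
  onPath-agree {ℓ} {x} {x′} xy x′y same with ℓ ℕ.≟ n
  ... | yes refl = subst (Agree (suc n) x) (agree-full⇒≡ (agree-trans xy (agree-sym x′y))) (agree-refl (suc n) x)
  ... | no  ℓ≢n  = agree-extend (agree-trans xy (agree-sym x′y))
                     (bitValue-injective (trans (sym (onPath-≢ x ℓ≢n)) (trans same (onPath-≢ x′ ℓ≢n))))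

valueBit : Fin 4 → Fin 2
valueBit (fsuc (fsuc fzero)) = fsuc fzero
valueBit _                   = fzero

valueBit-bitValue : ∀ b → valueBit (bitValue b) ≡ b
valueBit-bitValue fzero        = refl
valueBit-bitValue (fsuc fzero) = refl

module Hard (d : ℕ) where

  s m : ℕ
  s = 2 ℕ.^ d
  m = suc d ℕ.* s

  instance
    s≢0 : ℕ.NonZero s
    s≢0 = ℕₚ.m^n≢0 2 d

  Bits : Set
  Bits = Vec (Fin 2) d

  bits : Fin s → Bits
  bits σ = Vec.tabulate (finToFun σ)

  fromBits : Bits → Fin s
  fromBits v = funToFin (Vec.lookup v)

  bits-fromBits : ∀ v → bits (fromBits v) ≡ v
  bits-fromBits v = trans (Vecₚ.tabulate-cong (Finₚ.finToFun-funToFin (Vec.lookup v))) (Vecₚ.tabulate∘lookup v)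

  fromBits-bits : ∀ σ → fromBits (bits σ) ≡ σ
  fromBits-bits σ = trans (funToFin-cong {d} {2} (Vecₚ.lookup∘tabulate (finToFun σ))) (Finₚ.funToFin-finToFin {d} {2} σ)

  bits-injective : ∀ {σ τ} → bits σ ≡ bits τ → σ ≡ τ
  bits-injective {σ} {τ} eq = trans (sym (fromBits-bits σ)) (trans (cong fromBits eq) (fromBits-bits τ))

  level : Fin m → ℕ
  level i = toℕ (quotient {suc d} s i)

  rep : Fin m → Fin s
  rep = remainder {suc d} s

  item : ∀ ℓ → ℓ ≤ d → Bits → Fin m
  item ℓ ℓ≤d v = combine (fromℕ< (s≤s ℓ≤d)) (fromBits v)

  remQuot-item : ∀ ℓ ℓ≤d v → remQuot s (item ℓ ℓ≤d v) ≡ (fromℕ< (s≤s ℓ≤d) , fromBits v)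
  remQuot-item ℓ ℓ≤d v = Finₚ.remQuot-combine (fromℕ< (s≤s ℓ≤d)) (fromBits v)

  level-item : ∀ ℓ ℓ≤d v → level (item ℓ ℓ≤d v) ≡ ℓ
  level-item ℓ ℓ≤d v = trans (cong (toℕ ∘ proj₁) (remQuot-item ℓ ℓ≤d v)) (Finₚ.toℕ-fromℕ< (s≤s ℓ≤d))

  bits-rep-item : ∀ ℓ ℓ≤d v → bits (rep (item ℓ ℓ≤d v)) ≡ v
  bits-rep-item ℓ ℓ≤d v = trans (cong (bits ∘ proj₂) (remQuot-item ℓ ℓ≤d v)) (bits-fromBits v)

  real : Fin s → Fin m → Fin 4
  real σ i = value (bits σ) (level i) (bits (rep i))

  real-item : ∀ σ ℓ ℓ≤d v → real σ (item ℓ ℓ≤d v) ≡ value (bits σ) ℓ v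
  real-item σ ℓ ℓ≤d v = cong₂ (value (bits σ)) (level-item ℓ ℓ≤d v) (bits-rep-item ℓ ℓ≤d v)

  real≡GOOD⇒bits≡ : ∀ σ i → real σ i ≡ GOOD → bits σ ≡ bits (rep i)
  real≡GOOD⇒bits≡ σ i good = agree-full⇒≡ (subst (λ ℓ → Agree ℓ (bits σ) (bits (rep i))) full on-path)
    where
    on-path : Agree (level i) (bits σ) (bits (rep i))
    on-path = value≢OFF⇒agree λ off → contradiction (trans (sym good) off) λ ()
    full : level i ≡ d
    full = onPath≡GOOD⇒full (bits σ) (level i) (trans (sym (value-agree on-path)) good)

  real-injective : ∀ σ τ → (∀ i → real σ i ≡ real τ i) → σ ≡ τ
  real-injective σ τ same = bits-injective (sym (trans (real≡GOOD⇒bits≡ τ target τ-good) (bits-rep-item d ℕₚ.≤-refl (bits σ))))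
    where
    target : Fin m
    target = item d ℕₚ.≤-refl (bits σ)
    σ-good : real σ target ≡ GOOD
    σ-good = trans (real-item σ d ℕₚ.≤-refl (bits σ))
               (trans (value-agree (agree-refl d (bits σ))) (onPath-full (bits σ)))
    τ-good : real τ target ≡ GOOD
    τ-good = trans (sym (same target)) σ-good

  I : Instance s
  I = record
    { u = 4 ; m = m ; f = indicator GOOD ; monotone = indicator-mono GOOD ; submodular = indicator-submodular GOOD
    ; cost = λ _ → ℚ.1ℚ ; cost-pos = λ _ → ℚₚ.positive⁻¹ ℚ.1ℚ
    ; real = real ; real-inj = real-injective
    ; prob = λ _ → 1/ℕ s ; prob-pos = λ _ → 1/ℕ-pos s ; prob-sum = sumFin-1/ℕ s
    }

  open Instance I public
    using (Q; History; observed; covers; histCost; Tree; stop; probe; runTree; treeHist; TreeFeasible; treeExpCost;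
           RPol; rHist; RFeasible; rExpCost)

  histCost≡length : ∀ h → histCost h ≡ ℕ→ℚ (length h)
  histCost≡length []            = sym (ℕ→ℚ-≡-mkℚ 0)
  histCost≡length ((_ , _) ∷ h) = begin
    ℚ.1ℚ ℚ.+ histCost h          ≡⟨ cong₂ ℚ._+_ (sym ℕ→ℚ-1) (histCost≡length h) ⟩
    ℕ→ℚ 1 ℚ.+ ℕ→ℚ (length h)     ≡⟨ sym (ℕ→ℚ-+ 1 (length h)) ⟩
    ℕ→ℚ (suc (length h))         ∎
    where open ≡-Reasoning

  expectedCost : ∀ (hist : Fin s → History) →
                 sumFin (λ σ → 1/ℕ s ℚ.* histCost (hist σ)) ≡ 1/ℕ s ℚ.* ℕ→ℚ (sum λ σ → length (hist σ))
  expectedCost hist = trans (sumFin-cong λ σ → cong (1/ℕ s ℚ.*_) (histCost≡length (hist σ)))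
                            (sumFin-*-ℕ→ℚ (1/ℕ s) λ σ → length (hist σ))

  +≡⇒≤ : ∀ {ℓ j} → ℓ ℕ.+ j ≡ d → ℓ ≤ d
  +≡⇒≤ {ℓ} ℓ+j≡d = ℕₚ.m+n≤o⇒m≤o ℓ (ℕₚ.≤-reflexive ℓ+j≡d)

  descend : ∀ j ℓ → ℓ ℕ.+ j ≡ d → Bits → Tree
  descend zero    ℓ ℓ+j≡d v = probe (item ℓ (+≡⇒≤ ℓ+j≡d) v) λ _ → stop
  descend (suc j) ℓ ℓ+j≡d v = probe (item ℓ (+≡⇒≤ ℓ+j≡d) v) λ ρ →
    descend j (suc ℓ) (trans (sym (ℕₚ.+-suc ℓ j)) ℓ+j≡d) (setBit ℓ (valueBit ρ) v)

  GOOD∈observed-∷ : ∀ i ρ h → ρ ≡ GOOD → GOOD ∈ observed ((i , ρ) ∷ h)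
  GOOD∈observed-∷ i ρ h refl = x∈p∪q⁺ (inj₁ (x∈⁅x⁆ GOOD))

  descend-run : ∀ σ j ℓ ℓ+j≡d v h → Agree ℓ (bits σ) v →
                let h′ = runTree (descend j ℓ ℓ+j≡d v) (real σ) h in
                length h′ ≡ suc j ℕ.+ length h × GOOD ∈ observed h′
  descend-run σ zero ℓ ℓ+j≡d v h on-path = refl , GOOD∈observed-∷ i (real σ i) h (begin
    real σ i              ≡⟨ real-item σ ℓ (+≡⇒≤ ℓ+j≡d) v ⟩
    value (bits σ) ℓ v    ≡⟨ value-agree on-path ⟩
    onPath (bits σ) ℓ     ≡⟨ cong (onPath (bits σ)) (trans (sym (ℕₚ.+-identityʳ ℓ)) ℓ+j≡d) ⟩
    onPath (bits σ) d     ≡⟨ onPath-full (bits σ) ⟩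
    GOOD                  ∎)
    where
    open ≡-Reasoning
    i : Fin m
    i = item ℓ (+≡⇒≤ ℓ+j≡d) v
  descend-run σ (suc j) ℓ ℓ+j≡d v h on-path =
    Data.Product.map₁ (λ len → trans len (ℕₚ.+-suc (suc j) (length h)))
      (descend-run σ j (suc ℓ) _ (setBit ℓ (valueBit (real σ i)) v) ((i , real σ i) ∷ h) next-on-path)
    where
    i : Fin m
    i = item ℓ (+≡⇒≤ ℓ+j≡d) v
    learnt-bit : valueBit (real σ i) ≡ bitAt ℓ (bits σ)
    learnt-bit = begin
      valueBit (real σ i)                       ≡⟨ cong valueBit (trans (real-item σ ℓ (+≡⇒≤ ℓ+j≡d) v) (value-agree on-path)) ⟩
      valueBit (onPath (bits σ) ℓ)              ≡⟨ cong valueBit (onPath-≢ (bits σ) λ ℓ≡d → ℕₚ.m+1+n≢m ℓ (trans ℓ+j≡d (sym ℓ≡d))) ⟩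
      valueBit (bitValue (bitAt ℓ (bits σ)))    ≡⟨ valueBit-bitValue _ ⟩
      bitAt ℓ (bits σ)                          ∎
      where open ≡-Reasoning
    next-on-path : Agree (suc ℓ) (bits σ) (setBit ℓ (valueBit (real σ i)) v)
    next-on-path = subst (λ b → Agree (suc ℓ) (bits σ) (setBit ℓ b v)) (sym learnt-bit) (agree-setBit on-path)

  tree : Tree
  tree = descend d 0 refl (Vec.replicate d fzero)

  tree-run : ∀ σ → length (treeHist tree σ) ≡ suc d × GOOD ∈ observed (treeHist tree σ)
  tree-run σ = Data.Product.map₁ (λ len → trans len (ℕₚ.+-identityʳ (suc d)))
                 (descend-run σ d 0 refl (Vec.replicate d fzero) [] agree-zero)

  GOOD∈⇒covers : ∀ {h} → GOOD ∈ observed h → covers h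
  GOOD∈⇒covers GOOD∈h = trans (indicator-∈ GOOD GOOD∈h) (sym (indicator-∈ GOOD ∈⊤))

  covers⇒GOOD∈ : ∀ {h} → covers h → GOOD ∈ observed h
  covers⇒GOOD∈ covered = indicator≡1⇒∈ GOOD (trans covered (indicator-∈ GOOD ∈⊤))

  tree-feasible : TreeFeasible tree
  tree-feasible σ = GOOD∈⇒covers {treeHist tree σ} (proj₂ (tree-run σ))

  tree-cost : treeExpCost tree ≡ ℕ→ℚ (suc d)
  tree-cost = begin
    treeExpCost tree                                        ≡⟨ expectedCost (treeHist tree) ⟩
    1/ℕ s ℚ.* ℕ→ℚ (sum λ σ → length (treeHist tree σ))      ≡⟨ cong (λ n → 1/ℕ s ℚ.* ℕ→ℚ n) total-length ⟩
    1/ℕ s ℚ.* ℕ→ℚ (s ℕ.* suc d)                             ≡⟨ 1/ℕ-*-ℕ→ℚ-* s (suc d) ⟩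
    ℕ→ℚ (suc d)                                             ∎
    where
    open ≡-Reasoning
    total-length : sum (λ σ → length (treeHist tree σ)) ≡ s ℕ.* suc d
    total-length = trans (sum-cong-≗ (proj₁ ∘ tree-run)) (sum-const s (suc d))

  data Deepest (x : Fin m → Fin 4) (L : List (Fin m)) : Set where
    allOff : All (λ i → x i ≡ OFF) L → Deepest x L
    at     : ∀ p → x (List.lookup L p) ≢ OFF →
             All (λ i → x i ≢ OFF → level i ≤ level (List.lookup L p)) L → Deepest x L

  deepest : ∀ x L → Deepest x L
  deepest x []      = allOff []
  deepest x (i ∷ L) with x i Finₚ.≟ OFF | deepest x L
  ... | yes off | allOff offs  = allOff (off ∷ offs)
  ... | yes off | at p on below = at (fsuc p) on ((λ on′ → contradiction off on′) ∷ below)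
  ... | no  on  | allOff offs  = at fzero on ((λ _ → ℕₚ.≤-refl) ∷ All.map (λ off on′ → contradiction off on′) offs)
  ... | no  on  | at p on′ below with level (List.lookup L p) ℕₚ.≤? level i
  ...   | yes p≤i = at fzero on ((λ _ → ℕₚ.≤-refl) ∷ All.map (λ below-p on″ → ℕₚ.≤-trans (below-p on″) p≤i) below)
  ...   | no  p≰i = at (fsuc p) on′ ((λ _ → ℕₚ.<⇒≤ (ℕₚ.≰⇒> p≰i)) ∷ below)

  deepestCode : ∀ {x L} → Deepest x L → Fin (suc (length L)) × Fin 4
  deepestCode         (allOff _) = fzero , OFF
  deepestCode {x} {L} (at p _ _) = fsuc p , x (List.lookup L p)

  off-beyond : ∀ {x : Fin m → Fin 4} {i ℓ} → (x i ≢ OFF → level i ≤ ℓ) → ¬ level i ≤ ℓ → x i ≡ OFF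
  off-beyond {x} {i} below i≰ℓ with x i Finₚ.≟ OFF
  ... | yes off = off
  ... | no  on  = contradiction (below on) i≰ℓ

  -- The deepest on-path item w and its value fix the first level w + 1 bits of the scenario;
  -- these determine every item of level at most level w, and deeper items are OFF.
  deepestCode-injective : ∀ σ τ L → deepestCode (deepest (real σ) L) ≡ deepestCode (deepest (real τ) L) →
                          All (λ i → real σ i ≡ real τ i) L
  deepestCode-injective σ τ L same with deepest (real σ) L | deepest (real τ) L
  ... | allOff offσ | allOff offτ = All.zipWith (λ (offσᵢ , offτᵢ) → trans offσᵢ (sym offτᵢ)) (offσ , offτ)
  ... | allOff _    | at _ _ _    = contradiction (cong proj₁ same) λ ()
  ... | at _ _ _    | allOff _    = contradiction (cong proj₁ same) λ ()
  ... | at p onσ belowσ | at q onτ belowτ with Finₚ.suc-injective (cong proj₁ same)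
  ...   | refl = All.zipWith agree-at (belowσ , belowτ)
    where
    w : Fin m
    w = List.lookup L p
    pathσ : Agree (level w) (bits σ) (bits (rep w))
    pathσ = value≢OFF⇒agree onσ
    pathτ : Agree (level w) (bits τ) (bits (rep w))
    pathτ = value≢OFF⇒agree onτ
    σ∼τ : Agree (suc (level w)) (bits σ) (bits τ)
    σ∼τ = onPath-agree pathσ pathτ (trans (sym (value-agree pathσ)) (trans (cong proj₂ same) (value-agree pathτ)))
    agree-at : ∀ {i} → (real σ i ≢ OFF → level i ≤ level w) × (real τ i ≢ OFF → level i ≤ level w) →
               real σ i ≡ real τ i
    agree-at {i} (belowσᵢ , belowτᵢ) with level i ℕₚ.≤? level w
    ... | yes i≤w = value-prefix (bits (rep i)) (agree-≤ (s≤s i≤w) σ∼τ)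
    ... | no  i≰w = trans (off-beyond {real σ} belowσᵢ i≰w) (sym (off-beyond {real τ} belowτᵢ i≰w))

  module Budget (k : ℕ) where

    K : ℕ
    K = suc k ℕ.* 4

    short : ∀ (o : List (Fin m)) → suc (length (take k o)) ≤ suc k
    short o = s≤s (ℕₚ.≤-trans (ℕₚ.≤-reflexive (Listₚ.length-take k o)) (ℕₚ.m⊓n≤m k (length o)))

    summary : List (Fin m) → Fin s → Fin K
    summary o σ = combine (inject≤ (proj₁ code) (short o)) (proj₂ code)
      where
      code : Fin (suc (length (take k o))) × Fin 4
      code = deepestCode (deepest (real σ) (take k o))

    summary-injective : ∀ o σ τ → summary o σ ≡ summary o τ → All (λ i → real σ i ≡ real τ i) (take k o)
    summary-injective o σ τ same with Finₚ.combine-injective _ _ _ _ same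
    ... | same-position , same-value =
      deepestCode-injective σ τ (take k o)
        (cong₂ _,_ (Finₚ.inject≤-injective (short o) (short o) _ _ same-position) same-value)

    open Runs I
    open Transcripts k summary summary-injective

    cheap-injective : ∀ {r} (π : RPol r) → RFeasible π → ∀ σ τ → length (rHist π σ) ≤ k →
                      transcript π σ [] ≡ transcript π τ [] → σ ≡ τ
    cheap-injective π feasible σ τ cheap same =
      bits-injective (trans (real≡GOOD⇒bits≡ σ i σ-good) (sym (real≡GOOD⇒bits≡ τ i τ-good)))
      where
      same-run : rHist π σ ≡ rHist π τ
      same-run = runR-determined π σ τ [] same (subst (_ ≤_) (sym (ℕₚ.+-identityʳ k)) cheap)
      found : ∃ λ i → (i , GOOD) ∈ᴸ rHist π σ
      found = ∈-observed (rHist π σ) (covers⇒GOOD∈ {rHist π σ} (feasible σ))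
      i : Fin m
      i = proj₁ found
      σ-good : real σ i ≡ GOOD
      σ-good = All.lookup (runR-consistent π (real σ) [] []) (proj₂ found)
      τ-good : real τ i ≡ GOOD
      τ-good = All.lookup (runR-consistent π (real τ) [] []) (subst ((i , GOOD) ∈ᴸ_) same-run (proj₂ found))

    rounds-lowerBound : ∀ {r} (π : RPol r) → RFeasible π →
                        suc k ℕ.* s ≤ sum (λ σ → length (rHist π σ)) ℕ.+ suc k ℕ.* K ℕ.^ r
    rounds-lowerBound π feasible =
      sum-≥-if-few-small k _ (λ σ _ → transcript π σ []) (λ σ τ cheap _ → cheap-injective π feasible σ τ cheap)

module Parameters (r t : ℕ) (1≤r : 1 ≤ r) where

  -- Chosen so that K ^ r = X = s / 2.
  X d k : ℕ
  X = 2 ℕ.^ ((t ℕ.+ 2) ℕ.* r)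
  d = suc ((t ℕ.+ 2) ℕ.* r)
  k = ℕ.pred (2 ℕ.^ t)

  open Hard d public
  open Budget k

  suc-k : suc k ≡ 2 ℕ.^ t
  suc-k = ℕₚ.suc-pred (2 ℕ.^ t) {{ℕₚ.m^n≢0 2 t}}

  Kʳ≡X : K ℕ.^ r ≡ X
  Kʳ≡X = begin
    (suc k ℕ.* 4) ℕ.^ r            ≡⟨ cong (λ c → (c ℕ.* 4) ℕ.^ r) suc-k ⟩
    (2 ℕ.^ t ℕ.* 2 ℕ.^ 2) ℕ.^ r    ≡⟨ cong (ℕ._^ r) (sym (ℕₚ.^-distribˡ-+-* 2 t 2)) ⟩
    (2 ℕ.^ (t ℕ.+ 2)) ℕ.^ r        ≡⟨ ℕₚ.^-*-assoc 2 (t ℕ.+ 2) r ⟩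
    X                              ∎
    where open ≡-Reasoning

  a : ℕ
  a = 32 ℕ.* 2 ℕ.^ t

  module _ (π : RPol r) (feasible : RFeasible π) where

    total-length : ℕ
    total-length = sum λ σ → length (rHist π σ)

    total-length-lowerBound : 2 ℕ.^ t ℕ.* X ≤ total-length
    total-length-lowerBound = ℕₚ.+-cancelʳ-≤ (2 ℕ.^ t ℕ.* X) _ _ (subst₂ _≤_ double (cong (λ c → total-length ℕ.+ c) halves)
                                (rounds-lowerBound π feasible))
      where
      double : suc k ℕ.* s ≡ 2 ℕ.^ t ℕ.* X ℕ.+ 2 ℕ.^ t ℕ.* X
      double = trans (cong (ℕ._* s) suc-k) (lemma (2 ℕ.^ t) X)
        where
        lemma : ∀ p x → p ℕ.* (2 ℕ.* x) ≡ p ℕ.* x ℕ.+ p ℕ.* x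
        lemma = solve-∀
      halves : suc k ℕ.* K ℕ.^ r ≡ 2 ℕ.^ t ℕ.* X
      halves = cong₂ ℕ._*_ suc-k Kʳ≡X

    cost-lowerBound : 1/ℕ 64 ℚ.* ℕ→ℚ a ℚ.≤ rExpCost π
    cost-lowerBound = subst (_ ℚ.≤_) (sym (expectedCost (rHist π))) (ℕ-ratio-≤ 64 s {a} {total-length} (begin
      s ℕ.* a                         ≡⟨ lemma X (2 ℕ.^ t) ⟩
      64 ℕ.* (2 ℕ.^ t ℕ.* X)          ≤⟨ ℕₚ.*-monoʳ-≤ 64 total-length-lowerBound ⟩
      64 ℕ.* total-length             ∎))
      where
      open ℕₚ.≤-Reasoning
      lemma : ∀ x p → 2 ℕ.* x ℕ.* (32 ℕ.* p) ≡ 64 ℕ.* (p ℕ.* x)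
      lemma = solve-∀

  size-bound : s ℕ.* suc d ℕ.^ r ≤ (r ℕ.* r ℕ.* ⌈log₂ s ⌉ ℕ.* a) ℕ.^ r
  size-bound = subst (λ L → s ℕ.* suc d ℕ.^ r ≤ (r ℕ.* r ℕ.* L ℕ.* a) ℕ.^ r) (sym (⌈log₂2^n⌉≡n d)) (begin
    s ℕ.* suc d ℕ.^ r                              ≤⟨ ℕₚ.*-mono-≤ s≤ (ℕₚ.^-monoˡ-≤ r suc-d≤) ⟩
    (2 ℕ.^ (t ℕ.+ 4)) ℕ.^ r ℕ.* (2 ℕ.* d) ℕ.^ r    ≡⟨ sym (^-distribʳ-* (2 ℕ.^ (t ℕ.+ 4)) (2 ℕ.* d) r) ⟩
    (2 ℕ.^ (t ℕ.+ 4) ℕ.* (2 ℕ.* d)) ℕ.^ r          ≡⟨ cong (ℕ._^ r) (trans (cong (ℕ._* (2 ℕ.* d)) (ℕₚ.^-distribˡ-+-* 2 t 4))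
                                                                    (lemma (2 ℕ.^ t) d)) ⟩
    (d ℕ.* a) ℕ.^ r                                ≤⟨ ℕₚ.^-monoˡ-≤ r (ℕₚ.m≤n*m (d ℕ.* a) (r ℕ.* r) {{r*r≢0}}) ⟩
    (r ℕ.* r ℕ.* (d ℕ.* a)) ℕ.^ r                  ≡⟨ cong (ℕ._^ r) (sym (ℕₚ.*-assoc (r ℕ.* r) d a)) ⟩
    (r ℕ.* r ℕ.* d ℕ.* a) ℕ.^ r                    ∎)
    where
    open ℕₚ.≤-Reasoning
    lemma : ∀ p d → p ℕ.* 16 ℕ.* (2 ℕ.* d) ≡ d ℕ.* (32 ℕ.* p)
    lemma = solve-∀
    r*r≢0 : ℕ.NonZero (r ℕ.* r)
    r*r≢0 = ℕ.>-nonZero (ℕₚ.*-mono-≤ 1≤r 1≤r)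
    d≤ : d ≤ (t ℕ.+ 4) ℕ.* r
    d≤ = subst₂ _≤_ (ℕₚ.+-comm ((t ℕ.+ 2) ℕ.* r) 1) (split t r)
           (ℕₚ.+-monoʳ-≤ ((t ℕ.+ 2) ℕ.* r) (ℕₚ.≤-trans 1≤r (ℕₚ.m≤n*m r 2)))
      where
      split : ∀ t r → (t ℕ.+ 2) ℕ.* r ℕ.+ 2 ℕ.* r ≡ (t ℕ.+ 4) ℕ.* r
      split = solve-∀
    s≤ : s ≤ (2 ℕ.^ (t ℕ.+ 4)) ℕ.^ r
    s≤ = subst (s ≤_) (sym (ℕₚ.^-*-assoc 2 (t ℕ.+ 4) r)) (ℕₚ.^-monoʳ-≤ 2 d≤)
    suc-d≤ : suc d ≤ 2 ℕ.* d
    suc-d≤ = subst (suc d ≤_) (cong (d ℕ.+_) (sym (ℕₚ.+-identityʳ d))) (ℕₚ.+-monoˡ-≤ d (s≤s z≤n))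

  t≤s : t ≤ s
  t≤s = ℕₚ.≤-trans (ℕₚ.<⇒≤ (n<2^n t)) (ℕₚ.^-monoʳ-≤ 2 t≤d)
    where
    t≤d : t ≤ d
    t≤d = ℕₚ.≤-trans (ℕₚ.m≤m+n t 2) (ℕₚ.≤-trans (ℕₚ.m≤m*n (t ℕ.+ 2) r {{ℕ.>-nonZero 1≤r}}) (ℕₚ.n≤1+n _))

  tree-cost-pos : 0ℚ < treeExpCost tree
  tree-cost-pos = subst (0ℚ <_) (sym tree-cost) (ℕ→ℚ-pos (suc d))

  rounds-ratio : (π : RPol r) → RFeasible π → RatioBound (1/ℕ 64) r s (rExpCost π) (treeExpCost tree)
  rounds-ratio π feasible = subst (RatioBound (1/ℕ 64) r s (rExpCost π)) (sym tree-cost)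
    (ratioBound-fromℕ r s a (suc d) (ℚₚ.<⇒≤ (1/ℕ-pos 64)) size-bound (cost-lowerBound π feasible))

theorem1p5 : Σ ℚ λ c → 0ℚ < c × ((r : ℕ) → 1 ≤ r → (N : ℕ) →
               ∃ λ s → N ≤ s × Σ (Instance s) λ I →
                 Instance.Q I ≡ 1 ×
                 Σ (Instance.Tree I) λ T →
                   Instance.TreeFeasible I T ×
                   0ℚ < Instance.treeExpCost I T ×
                   ((π : Instance.RPol I r) → Instance.RFeasible I π →
                      RatioBound c r s (Instance.rExpCost I π) (Instance.treeExpCost I T)))
theorem1p5 = 1/ℕ 64 , 1/ℕ-pos 64 , λ r 1≤r N → let open Parameters r N 1≤r in
  s , t≤s , I , indicator-∈ GOOD ∈⊤ , tree , tree-feasible , tree-cost-pos , rounds-ratio
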